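{- Every flat $\curlyvee$-algebra is simple (every homomorphism from it to a $\curlyvee$-algebra is either injective or constant), and hence subdirectly irreducible.
   Context: A flat $\curlyvee$-algebra is an algebra $(S,\curlyvee)$ with an element $0\in S$ such that $a\curlyvee b=0$ whenever $a,b$ are distinct and both different from $0$, $a\curlyvee a=a$, and $a\curlyvee 0=0\curlyvee a=a$ for all $a\in S$. A $\curlyvee$-algebra is an algebra $(S,\curlyvee)$ with a binary operation such that, setting $a\sqcup b=a\curlyvee(a\curlyvee b)$: $(S,\sqcup)$ is a left regular band (associative, $a\sqcup a=a$, $a\sqcup b\sqcup a=a\sqcup b$); $\curlyvee$ is commutative and idempotent; $(a\curlyvee b)\sqcup(a\sqcup b)=a\sqcup b$; $a\sqcup(b\curlyvee c)=(a\sqcup b)\curlyvee(a\sqcup c)$; and, writing $x\lesssim y$ iff $y\sqcup x=y$: if $d\lesssim a,b,c,a\curlyvee b,b\curlyvee c$ then $d\lesssim a\curlyvee c$. -}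

module Defs where

open import Level using (Level)
open import Relation.Binary.PropositionalEquality using (_≡_; _≢_)

module VeeOps {a : Level} {S : Set a} (_⋎_ : S → S → S) where
  infixl 6 _⊔_
  _⊔_ : S → S → S
  x ⊔ y = x ⋎ (x ⋎ y)

  infix 4 _≲_
  _≲_ : S → S → Set a
  x ≲ y = y ⊔ x ≡ y

module _ {a : Level} {S : Set a} (_⋎_ : S → S → S) where
  open VeeOps _⋎_

  record IsVeeAlgebra : Set a where
    field
      ⊔-assoc : ∀ x y z → (x ⊔ y) ⊔ z ≡ x ⊔ (y ⊔ z)
      ⊔-idem  : ∀ x → x ⊔ x ≡ x
      ⊔-lrb   : ∀ x y → x ⊔ y ⊔ x ≡ x ⊔ y
      ⋎-comm  : ∀ x y → x ⋎ y ≡ y ⋎ x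
      ⋎-idem  : ∀ x → x ⋎ x ≡ x
      ⋎-⊔-absorb : ∀ x y → (x ⋎ y) ⊔ (x ⊔ y) ≡ x ⊔ y
      ⊔-distrib-⋎ : ∀ x y z → x ⊔ (y ⋎ z) ≡ (x ⊔ y) ⋎ (x ⊔ z)
      ≲-⋎ : ∀ d x y z → d ≲ x → d ≲ y → d ≲ z → d ≲ x ⋎ y → d ≲ y ⋎ z
              → d ≲ x ⋎ z

  record IsFlatVeeAlgebra : Set a where
    field
      𝟘 : S
      flat-distinct : ∀ x y → x ≢ y → x ≢ 𝟘 → y ≢ 𝟘 → x ⋎ y ≡ 𝟘
      flat-idem     : ∀ x → x ⋎ x ≡ x
      flat-zeroʳ    : ∀ x → x ⋎ 𝟘 ≡ x
      flat-zeroˡ    : ∀ x → 𝟘 ⋎ x ≡ x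

{-# OPTIONS --safe #-}
module Submission where

open import Defs
open import Level using (_⊔_; Lift; lift; lower)
open import Data.Sum using (_⊎_; inj₁; inj₂)
open import Data.Product using (∃₂; _×_; _,_)
open import Function.Definitions using (Injective)
open import Relation.Binary.Definitions using (DecidableEquality)
open import Relation.Binary.PropositionalEquality
  using (_≡_; _≢_; refl; sym; trans; cong; module ≡-Reasoning)
open import Relation.Nullary.Decidable using (yes; no; map′; decidable-stable)
open import Data.Empty using (⊥-elim)
open import Axiom.ExcludedMiddle using (ExcludedMiddle)

-- Distinct nonzero x, y of a flat algebra have x ⋎ y = 𝟘, so a homomorphism f
-- into an idempotent algebra that identifies two distinct elements also
-- identifies some nonzero c with 𝟘; then every other nonzero x satisfies
-- f x = f x ⋎′ f 𝟘 = f x ⋎′ f c = f (x ⋎ c) = f 𝟘.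

ExcludedMiddle-lower : ∀ {a} b → ExcludedMiddle (a ⊔ b) → ExcludedMiddle a
ExcludedMiddle-lower b em = map′ lower lift (em {Lift b _})

module FlatHomomorphism
  {a b} {S : Set a} {_⋎_ : S → S → S} (flat : IsFlatVeeAlgebra _⋎_)
  (_≟_ : DecidableEquality S)
  {T : Set b} {_⋎′_ : T → T → T} (⋎′-idem : ∀ y → y ⋎′ y ≡ y)
  {f : S → T} (hom : ∀ x y → f (x ⋎ y) ≡ f x ⋎′ f y)
  where

  open IsFlatVeeAlgebra flat
  open ≡-Reasoning

  fx≡fx⋎′f𝟘 : ∀ x → f x ≡ f x ⋎′ f 𝟘
  fx≡fx⋎′f𝟘 x = begin
    f x         ≡⟨ cong f (flat-zeroʳ x) ⟨
    f (x ⋎ 𝟘)   ≡⟨ hom x 𝟘 ⟩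
    f x ⋎′ f 𝟘  ∎

  fx⋎′fy≡f𝟘 : ∀ {x y} → x ≢ y → x ≢ 𝟘 → y ≢ 𝟘 → f x ⋎′ f y ≡ f 𝟘
  fx⋎′fy≡f𝟘 {x} {y} x≢y x≢𝟘 y≢𝟘 = begin
    f x ⋎′ f y  ≡⟨ hom x y ⟨
    f (x ⋎ y)   ≡⟨ cong f (flat-distinct x y x≢y x≢𝟘 y≢𝟘) ⟩
    f 𝟘         ∎

  nonzero-collision⇒f≡f𝟘 : ∀ {x y} → x ≢ y → x ≢ 𝟘 → y ≢ 𝟘 →
                           f x ≡ f y → f x ≡ f 𝟘
  nonzero-collision⇒f≡f𝟘 {x} {y} x≢y x≢𝟘 y≢𝟘 fx≡fy = begin
    f x         ≡⟨ ⋎′-idem (f x) ⟨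
    f x ⋎′ f x  ≡⟨ cong (f x ⋎′_) fx≡fy ⟩
    f x ⋎′ f y  ≡⟨ fx⋎′fy≡f𝟘 x≢y x≢𝟘 y≢𝟘 ⟩
    f 𝟘         ∎

  nonzero-f≡f𝟘⇒constant : ∀ {c} → c ≢ 𝟘 → f c ≡ f 𝟘 → ∀ x → f x ≡ f 𝟘
  nonzero-f≡f𝟘⇒constant {c} c≢𝟘 fc≡f𝟘 x with x ≟ 𝟘 | x ≟ c
  ... | yes refl | _        = refl
  ... | no _     | yes refl = fc≡f𝟘
  ... | no x≢𝟘   | no x≢c   = begin
    f x         ≡⟨ fx≡fx⋎′f𝟘 x ⟩
    f x ⋎′ f 𝟘  ≡⟨ cong (f x ⋎′_) fc≡f𝟘 ⟨
    f x ⋎′ f c  ≡⟨ fx⋎′fy≡f𝟘 x≢c x≢𝟘 c≢𝟘 ⟩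
    f 𝟘         ∎

  collision⇒f≡f𝟘 : ∀ {x y} → x ≢ y → f x ≡ f y → ∀ z → f z ≡ f 𝟘
  collision⇒f≡f𝟘 {x} {y} x≢y fx≡fy with x ≟ 𝟘 | y ≟ 𝟘
  ... | yes refl | yes refl = ⊥-elim (x≢y refl)
  ... | yes refl | no y≢𝟘   = nonzero-f≡f𝟘⇒constant y≢𝟘 (sym fx≡fy)
  ... | no x≢𝟘   | yes refl = nonzero-f≡f𝟘⇒constant x≢𝟘 fx≡fy
  ... | no x≢𝟘   | no y≢𝟘   = nonzero-f≡f𝟘⇒constant x≢𝟘
                                (nonzero-collision⇒f≡f𝟘 x≢y x≢𝟘 y≢𝟘 fx≡fy)

  collision⇒constant : ∀ {x y} → x ≢ y → f x ≡ f y → ∀ u v → f u ≡ f v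
  collision⇒constant x≢y fx≡fy u v =
    trans (collision⇒f≡f𝟘 x≢y fx≡fy u) (sym (collision⇒f≡f𝟘 x≢y fx≡fy v))

proposition4p2 : ∀ {a b} → ExcludedMiddle (a ⊔ b)
    → (S : Set a) (_⋎_ : S → S → S) → IsFlatVeeAlgebra _⋎_
    → (T : Set b) (_⋎′_ : T → T → T) → IsVeeAlgebra _⋎′_
    → (f : S → T) → (∀ x y → f (x ⋎ y) ≡ f x ⋎′ f y)
    → Injective _≡_ _≡_ f ⊎ (∀ x y → f x ≡ f y)
proposition4p2 {b = b} em _ _ flat _ _⋎′_ vee f hom
  with em {∃₂ λ x y → x ≢ y × f x ≡ f y}
... | yes (_ , _ , x≢y , fx≡fy) = inj₂ (collision⇒constant x≢y fx≡fy)
  where open FlatHomomorphism flat (λ _ _ → ExcludedMiddle-lower b em)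
                              {_⋎′_ = _⋎′_} (IsVeeAlgebra.⋎-idem vee) {f} hom
... | no no-collision = inj₁ λ {u} {v} fu≡fv →
  decidable-stable (ExcludedMiddle-lower b em) λ u≢v → no-collision (u , v , u≢v , fu≡fv)
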